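{- Let $G$ be a bipartite graph with parts $A$ and $B$ that has no matching of size $k$. If $|A|\ge k$ and every vertex of $A$ has degree at least $k-1$, then there is a set of $k-1$ vertices of $B$ such that every vertex of $A$ has exactly this set as its neighborhood. -}

module Defs where

open import Data.Nat using (ℕ)
open import Data.Bool using (Bool; T)
open import Data.Fin using (Fin)
open import Data.Fin.Subset using (Subset)
open import Data.Vec using (tabulate)
open import Data.Product using (Σ; _×_)
open import Function.Definitions using (Injective)
open import Relation.Binary.PropositionalEquality using (_≡_)

-- A (finite) bipartite graph with parts A = Fin m and B = Fin n,
-- given by its adjacency relation between the two parts.
BipGraph : ℕ → ℕ → Set
BipGraph m n = Fin m → Fin n → Bool

N : ∀ {m n} → BipGraph m n → Fin m → Subset n
N G a = tabulate (G a)

HasMatching : ∀ {m n} → BipGraph m n → ℕ → Set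
HasMatching {m} {n} G k =
  Σ (Fin k → Fin m) λ f → Σ (Fin k → Fin n) λ g →
    Injective _≡_ _≡_ f × Injective _≡_ _≡_ g × (∀ i → T (G (f i) (g i)))

{-# OPTIONS --safe #-}
-- Write k = j + 1. If a vertex a had more than j neighbours, take j further
-- vertices of A: each has at least j neighbours, so they can be matched
-- greedily, and a still has a free neighbour afterwards; this is a matching
-- of size j + 1. Hence every neighbourhood has exactly j elements. If now
-- b ∈ N a but b ∉ N a', delete a and all edges at b: every degree drops by
-- at most one while a' keeps its j neighbours, so by the first step the
-- smaller graph has a matching of size j, and adding the edge ab gives one of
-- size j + 1. Hence all neighbourhoods coincide.
module Submission where

open import Defs
open import Data.Nat using (ℕ; zero; suc; _≥_; _∸_; _≤_; _<_; s≤s)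
open import Data.Nat.Properties using (≤-antisym; ≤-trans; ≤-pred; ≤-reflexive; <⇒≤; <⇒≢; ≮⇒≥; m≤n⇒m≤1+n)
open import Data.Bool using (T)
open import Data.Bool.Properties using (T-≡)
open import Data.Fin using (Fin; zero; suc; punchIn; punchOut; inject≤)
open import Data.Fin.Properties using (punchIn-injective; punchInᵢ≢i; punchIn-punchOut; inject≤-injective)
open import Data.Fin.Subset using (Subset; ∣_∣; _∈_; _∉_; _-_; ⁅_⁆; inside; outside)
open import Data.Fin.Subset.Properties using (_∈?_; nonempty?; Empty-unique; ∣⊥∣≡0; p─⊥≡p; p─q⊆p; x∈p∧x≢y⇒x∈p-y; p⊆q⇒∣p∣≤∣q∣; ⊆-antisym)
open import Data.Vec as Vec using (lookup)
open import Data.Vec.Properties using (lookup∘tabulate; tabulate∘lookup; []=⇒lookup; lookup⇒[]=)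
open import Data.Vec.Functional using (_∷_)
open import Data.Product using (Σ; ∃; _×_; _,_; proj₁)
open import Function using (_∘_; Equivalence)
open import Function.Definitions using (Injective)
open import Relation.Nullary using (¬_; yes; no; contradiction)
open import Relation.Nullary.Decidable using (decidable-stable)
open import Relation.Binary.PropositionalEquality using (_≡_; _≢_; refl; sym; trans; cong; subst)

private variable
  m n t j : ℕ

x∉p-x : ∀ (p : Subset n) x → x ∉ p - x
x∉p-x (s Vec.∷ p) (suc x) (Vec.there x∈p-x) = x∉p-x p x x∈p-x

x∈p-y⇒x≢y : ∀ (p : Subset n) y {x} → x ∈ p - y → x ≢ y
x∈p-y⇒x≢y p y x∈p-x refl = x∉p-x p y x∈p-x

x∈p-y⇒x∈p : ∀ (p : Subset n) y {x} → x ∈ p - y → x ∈ p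
x∈p-y⇒x∈p p y = p─q⊆p p ⁅ y ⁆

∣p∣≤1+∣p-x∣ : ∀ (p : Subset n) x → ∣ p ∣ ≤ suc ∣ p - x ∣
∣p∣≤1+∣p-x∣ (inside  Vec.∷ p) zero    = s≤s (≤-reflexive (cong ∣_∣ (sym (p─⊥≡p p))))
∣p∣≤1+∣p-x∣ (outside Vec.∷ p) zero    = m≤n⇒m≤1+n (≤-reflexive (cong ∣_∣ (sym (p─⊥≡p p))))
∣p∣≤1+∣p-x∣ (inside  Vec.∷ p) (suc x) = s≤s (∣p∣≤1+∣p-x∣ p x)
∣p∣≤1+∣p-x∣ (outside Vec.∷ p) (suc x) = ∣p∣≤1+∣p-x∣ p x

x∉p⇒∣p∣≤∣p-x∣ : ∀ (p : Subset n) x → x ∉ p → ∣ p ∣ ≤ ∣ p - x ∣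
x∉p⇒∣p∣≤∣p-x∣ p x x∉p =
  p⊆q⇒∣p∣≤∣q∣ {p = p} {p - x} λ y∈p → x∈p∧x≢y⇒x∈p-y y∈p λ { refl → x∉p y∈p }

∃-∈-outside-image : ∀ (p : Subset n) (g : Fin t → Fin n) → t < ∣ p ∣ →
  ∃ λ x → x ∈ p × ∀ i → g i ≢ x
∃-∈-outside-image {n} {zero} p g 0<∣p∣ with nonempty? p
... | yes (x , x∈p) = x , x∈p , λ ()
... | no ∅ = contradiction (sym (trans (cong ∣_∣ (Empty-unique ∅)) (∣⊥∣≡0 n))) (<⇒≢ 0<∣p∣)
∃-∈-outside-image {t = suc t} p g 1+t<∣p∣ =
  let x , x∈p-g₀ , g∘suc≢x = ∃-∈-outside-image (p - g zero) (g ∘ suc)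
                               (≤-pred (≤-trans 1+t<∣p∣ (∣p∣≤1+∣p-x∣ p (g zero))))
  in x , x∈p-y⇒x∈p p (g zero) x∈p-g₀ ,
     λ { zero → x∈p-y⇒x≢y p (g zero) x∈p-g₀ ∘ sym ; (suc i) → g∘suc≢x i }

injective-∷ : ∀ {A : Set} {x : A} {f : Fin t → A} →
  Injective _≡_ _≡_ f → (∀ i → f i ≢ x) → Injective _≡_ _≡_ (x ∷ f)
injective-∷ f-inj f≢x {zero}  {zero}  _     = refl
injective-∷ f-inj f≢x {zero}  {suc j} x≡fj  = contradiction (sym x≡fj) (f≢x j)
injective-∷ f-inj f≢x {suc i} {zero}  fi≡x  = contradiction fi≡x (f≢x i)
injective-∷ f-inj f≢x {suc i} {suc j} fi≡fj = cong suc (f-inj fi≡fj)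

injective-∷-punchIn : ∀ {a : Fin (suc m)} {f : Fin t → Fin m} →
  Injective _≡_ _≡_ f → Injective _≡_ _≡_ (a ∷ punchIn a ∘ f)
injective-∷-punchIn {a = a} f-inj =
  injective-∷ (f-inj ∘ punchIn-injective a _ _) (λ i → punchInᵢ≢i a _)

∈N⇒adjacent : ∀ (G : BipGraph m n) {a b} → b ∈ N G a → T (G a b)
∈N⇒adjacent G {a} {b} b∈Na =
  Equivalence.from T-≡ (trans (sym (lookup∘tabulate (G a) b)) ([]=⇒lookup b∈Na))

adjacent⇒∈N : ∀ (G : BipGraph m n) {a b} → T (G a b) → b ∈ N G a
adjacent⇒∈N G {a} {b} ab =
  lookup⇒[]= b (N G a) (trans (lookup∘tabulate (G a) b) (Equivalence.to T-≡ ab))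

Matches : BipGraph m n → (Fin t → Fin m) → Set
Matches {n = n} {t = t} G c =
  Σ (Fin t → Fin n) λ g → Injective _≡_ _≡_ g × (∀ i → T (G (c i) (g i)))

matches⇒hasMatching : ∀ (G : BipGraph m n) {c : Fin t → Fin m} →
  Injective _≡_ _≡_ c → Matches G c → HasMatching G t
matches⇒hasMatching G {c} c-inj (g , g-inj , adj) = c , g , c-inj , g-inj , adj

hasMatching-zero : ∀ (G : BipGraph m n) → HasMatching G 0
hasMatching-zero G = (λ ()) , (λ ()) , (λ { {()} }) , (λ { {()} }) , (λ ())

extend-matching : ∀ (G : BipGraph m n) {c : Fin (suc t) → Fin m} {b}
  (M : Matches G (c ∘ suc)) → T (G (c zero) b) → (∀ i → proj₁ M i ≢ b) → Matches G c
extend-matching G {b = b} (g , g-inj , adj) c₀b g≢b =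
  b ∷ g , injective-∷ g-inj g≢b , λ { zero → c₀b ; (suc i) → adj i }

extend-matching-by-degree : ∀ (G : BipGraph m n) {c : Fin (suc t) → Fin m} →
  Matches G (c ∘ suc) → t < ∣ N G (c zero) ∣ → Matches G c
extend-matching-by-degree G {c} M@(g , _) t<deg =
  let b , b∈N , g≢b = ∃-∈-outside-image (N G (c zero)) g t<deg
  in extend-matching G M (∈N⇒adjacent G b∈N) g≢b

greedy-matching : ∀ (G : BipGraph m n) t (c : Fin t → Fin m) →
  (∀ i → t ≤ ∣ N G (c i) ∣) → Matches G c
greedy-matching G zero    c deg = (λ ()) , (λ { {()} }) , (λ ())
greedy-matching G (suc t) c deg =
  extend-matching-by-degree G (greedy-matching G t (c ∘ suc) (<⇒≤ ∘ deg ∘ suc)) (deg zero)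

matching-of-large-degree : ∀ (G : BipGraph (suc m) n) → j ≤ m → (∀ a → j ≤ ∣ N G a ∣) →
  ∀ a → j < ∣ N G a ∣ → HasMatching G (suc j)
matching-of-large-degree {m = m} {j = j} G j≤m deg a j<deg =
  matches⇒hasMatching G (injective-∷-punchIn (inject≤-injective j≤m j≤m _ _))
    (extend-matching-by-degree G {a ∷ others} (greedy-matching G j others (deg ∘ others)) j<deg)
  where
  others : Fin j → Fin (suc m)
  others i = punchIn a (inject≤ i j≤m)

_∖_ : BipGraph m n → Fin n → BipGraph m n
(G ∖ b) a = lookup (N G a - b)

N-∖ : ∀ (G : BipGraph m n) b a → N (G ∖ b) a ≡ N G a - b
N-∖ G b a = tabulate∘lookup (N G a - b)

∣N∣≤1+∣N-∖∣ : ∀ (G : BipGraph m n) b a → ∣ N G a ∣ ≤ suc ∣ N (G ∖ b) a ∣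
∣N∣≤1+∣N-∖∣ G b a rewrite N-∖ G b a = ∣p∣≤1+∣p-x∣ (N G a) b

∉N⇒∣N∣≤∣N-∖∣ : ∀ (G : BipGraph m n) {b a} → b ∉ N G a → ∣ N G a ∣ ≤ ∣ N (G ∖ b) a ∣
∉N⇒∣N∣≤∣N-∖∣ G {b} {a} b∉Na rewrite N-∖ G b a = x∉p⇒∣p∣≤∣p-x∣ (N G a) b b∉Na

add-edge : ∀ (G : BipGraph (suc m) n) {a b} → b ∈ N G a →
  HasMatching ((G ∖ b) ∘ punchIn a) t → HasMatching G (suc t)
add-edge G {a} {b} b∈Na (f , g , f-inj , g-inj , adj) =
  matches⇒hasMatching G (injective-∷-punchIn f-inj)
    (extend-matching G {a ∷ punchIn a ∘ f}
      (g , g-inj , λ i → ∈N⇒adjacent G (x∈p-y⇒x∈p _ b (g∈ i)))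
      (∈N⇒adjacent G b∈Na)
      (λ i → x∈p-y⇒x≢y _ b (g∈ i)))
  where
  g∈ : ∀ i → g i ∈ N G (punchIn a (f i)) - b
  g∈ i = subst (g i ∈_) (N-∖ G b (punchIn a (f i)))
               (adjacent⇒∈N (G ∖ b) {punchIn a (f i)} (adj i))

matching-of-unshared-neighbour : ∀ (G : BipGraph (suc m) n) → j ≤ m → (∀ a → j ≤ ∣ N G a ∣) →
  ∀ {a a' b} → b ∈ N G a → b ∉ N G a' → HasMatching G (suc j)
matching-of-unshared-neighbour {j = zero} G _ _ {a} {b = b} b∈Na _ =
  add-edge G b∈Na (hasMatching-zero ((G ∖ b) ∘ punchIn a))
matching-of-unshared-neighbour {j = suc j} G (s≤s j≤m) deg {a} {a'} {b} b∈Na b∉Na' =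
  add-edge G b∈Na
    (matching-of-large-degree ((G ∖ b) ∘ punchIn a) j≤m deg-∖ (punchOut a≢a') deg-∖-a')
  where
  a≢a' : a ≢ a'
  a≢a' refl = b∉Na' b∈Na

  deg-∖ : ∀ x → j ≤ ∣ N (G ∖ b) (punchIn a x) ∣
  deg-∖ x = ≤-pred (≤-trans (deg (punchIn a x)) (∣N∣≤1+∣N-∖∣ G b (punchIn a x)))

  deg-∖-a' : j < ∣ N (G ∖ b) (punchIn a (punchOut a≢a')) ∣
  deg-∖-a' rewrite punchIn-punchOut a≢a' = ≤-trans (deg a') (∉N⇒∣N∣≤∣N-∖∣ G b∉Na')

proposition1 : (m n k : ℕ) (G : BipGraph m n) → ¬ HasMatching G k → m ≥ k →
    (∀ a → ∣ N G a ∣ ≥ k ∸ 1) →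
    Σ (Subset n) λ S → (∣ S ∣ ≡ k ∸ 1) × (∀ a → N G a ≡ S)
proposition1 m n zero G noM _ _ = contradiction (hasMatching-zero G) noM
proposition1 (suc m) n (suc j) G noM (s≤s j≤m) deg =
  N G zero , ∣N∣≡j zero , λ a → ⊆-antisym (N⊆N a zero) (N⊆N zero a)
  where
  ∣N∣≡j : ∀ a → ∣ N G a ∣ ≡ j
  ∣N∣≡j a = ≤-antisym (≮⇒≥ (noM ∘ matching-of-large-degree G j≤m deg a)) (deg a)

  N⊆N : ∀ a a' {b} → b ∈ N G a → b ∈ N G a'
  N⊆N a a' {b} b∈Na =
    decidable-stable (b ∈? N G a') (noM ∘ matching-of-unshared-neighbour G j≤m deg b∈Na)
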